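{- Assume $\mathfrak{f}=\mathfrak{m}\mathfrak{n}$ with $\mathfrak{m},\mathfrak{n}\in\mathbb{F}_q[t]$ monic of positive degree. Then (1) $\operatorname{O}^{(2)}_{\mathfrak{f}}=\mathfrak{m}(X_1)\operatorname{O}^{(2)}_{\mathfrak{n}}+\mathfrak{n}(X_2)\operatorname{O}^{(2)}_{\mathfrak{m}}$ (all operators in the variables $X_1,X_2$); (2) in particular, if $\mathfrak{f}=(t-\zeta)\mathfrak{n}$ with $\zeta\in\mathbb{F}_q$, then $\operatorname{O}^{(2)}_{\mathfrak{f}}=(X_1-\zeta)\operatorname{O}^{(2)}_{\mathfrak{n}}+\mathfrak{n}(X_2)$.
   Context: Let $\mathbb{F}_q$ be a finite field. For a monic $\mathfrak{g}(t)=b_mt^m+\cdots+b_0\in\mathbb{F}_q[t]$ of degree $m\ge1$, define $\operatorname{D}_{\mathfrak{g}}(X^i)=\sum_{j=0}^{m-i-1}b_{i+j+1}X^j$ for $0\le i\le m-1$ (extended $\mathbb{F}_q$-linearly) and the rank-two Weil operator $\operatorname{O}^{(2)}_{\mathfrak{g}}(X_1,X_2)=\sum_{k=0}^{m-1}\operatorname{D}_{\mathfrak{g}}(X_1^k)X_2^k$. -}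

module Defs where

open import Level using (Level; _⊔_)
open import Algebra.Bundles using (CommutativeRing)
open import Data.Nat as N using (ℕ; zero; suc; _∸_; _≤_)
open import Data.Fin using (Fin)
open import Data.List using (List; []; _∷_; _++_; length; map; upTo; replicate; foldr)
open import Data.Product using (Σ; ∃; _×_)
open import Relation.Nullary using (¬_)

record FiniteField (c ℓ : Level) : Set (Level.suc (c ⊔ ℓ)) where
  field
    commRing : CommutativeRing c ℓ
  open CommutativeRing commRing public
  field
    1≉0       : ¬ (1# ≈ 0#)
    inverse   : ∀ x → ¬ (x ≈ 0#) → ∃ λ y → (x * y) ≈ 1#
    q         : ℕ
    enum      : Fin q → Carrier
    enum-surj : ∀ x → ∃ λ i → enum i ≈ x

module Poly {c ℓ : Level} (R : CommutativeRing c ℓ) where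
  open CommutativeRing R

  -- univariate polynomials in F[t] as coefficient lists, lowest degree first
  Poly : Set c
  Poly = List Carrier

  coeff : Poly → ℕ → Carrier
  coeff []       _       = 0#
  coeff (a ∷ _)  zero    = a
  coeff (_ ∷ as) (suc i) = coeff as i

  -- degree of a (monic, hence normalised) polynomial
  deg : Poly → ℕ
  deg p = length p ∸ 1

  Monic : Poly → Set ℓ
  Monic p = (1 ≤ length p) × (coeff p (length p ∸ 1) ≈ 1#)

  sumTo : (ℕ → Carrier) → ℕ → Carrier
  sumTo f zero    = 0#
  sumTo f (suc n) = sumTo f n + f n

  _*ₚ_ : Poly → Poly → Poly
  p *ₚ r = map (λ n → sumTo (λ i → coeff p i * coeff r (n ∸ i)) (suc n))
               (upTo (length p N.+ length r ∸ 1))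

  monom : ℕ → Poly
  monom k = replicate k 0# ++ (1# ∷ [])

  -- bivariate polynomials in X₁, X₂, given by their coefficient of X₁^j X₂^k
  Poly2 : Set c
  Poly2 = ℕ → ℕ → Carrier

  _≈₂_ : Poly2 → Poly2 → Set ℓ
  P ≈₂ Q = ∀ j k → P j k ≈ Q j k

  0₂ : Poly2
  0₂ _ _ = 0#

  _+₂_ : Poly2 → Poly2 → Poly2
  (P +₂ Q) j k = P j k + Q j k

  inX1 : Poly → Poly2
  inX1 p j zero    = coeff p j
  inX1 p j (suc k) = 0#

  inX2 : Poly → Poly2
  inX2 p zero    k = coeff p k
  inX2 p (suc j) k = 0#

  mulX1 : Poly → Poly2 → Poly2
  mulX1 p P j k = sumTo (λ i → coeff p i * P (j ∸ i) k) (suc j)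

  mulX2 : Poly → Poly2 → Poly2
  mulX2 p P j k = sumTo (λ i → coeff p i * P j (k ∸ i)) (suc k)

  -- D_g(X^i) = Σ_{j=0}^{m-i-1} b_{i+j+1} X^j   (m = deg g, 0 ≤ i ≤ m-1)
  D : Poly → ℕ → Poly
  D g i = map (λ j → coeff g (i N.+ j N.+ 1)) (upTo (deg g ∸ i))

  -- O^(2)_g(X₁,X₂) = Σ_{k=0}^{m-1} D_g(X₁^k) X₂^k
  O2 : Poly → Poly2
  O2 g = foldr (λ k acc → mulX2 (monom k) (inX1 (D g k)) +₂ acc) 0₂ (upTo (deg g))

{-# OPTIONS --safe #-}
-- O2 g is the difference quotient (g(X₁) − g(X₂)) / (X₁ − X₂): its coefficient of X₁^j X₂^k
-- is b_{j+k+1}. Part (1) is then the coefficient form of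
--   (mn)(X₁) − (mn)(X₂) = m(X₁) (n(X₁) − n(X₂)) + n(X₂) (m(X₁) − m(X₂)),
-- obtained by splitting the Cauchy sum for the coefficient j+k+1 of mn after its first j+1 terms.
-- Part (2) follows since O2 (t − ζ) = 1.
module Submission where

open import Defs
open import Level using (Level)
open import Algebra.Bundles using (CommutativeRing)
open import Data.Nat as Nat using (ℕ; zero; suc; _∸_; _≤_; _<_; z≤n; s≤s; s≤s⁻¹)
open import Data.Nat.Properties as ℕₚ using ()
open import Data.Nat.Tactic.RingSolver using (solve-∀)
open import Data.List using ([]; _∷_; length; map; upTo; applyUpTo; foldr)
open import Data.List.Properties using (map-upTo)
open import Data.Product using (_×_; _,_)
open import Data.Sum using (inj₁; inj₂)
open import Data.Empty using (⊥-elim)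
open import Function using (id; _∘_)
open import Relation.Nullary using (Dec; yes; no)
open import Relation.Binary.Definitions using (tri<; tri≈; tri>)
open import Relation.Binary.PropositionalEquality as ≡ using (_≡_; _≢_)

private module Indices where
  open Nat using (_+_)

  split-point : ∀ j k → suc (k + j + 1) ≡ suc j + suc k
  split-point = solve-∀

  index-swap : ∀ j x → suc j + x ≡ x + j + 1
  index-swap = solve-∀

  index-low : ∀ {i j} k → i ≤ j → k + j + 1 ∸ i ≡ k + (j ∸ i) + 1
  index-low {i} {j} k i≤j = begin
    k + j + 1 ∸ i    ≡⟨ ℕₚ.+-∸-comm 1 (ℕₚ.m≤n⇒m≤o+n k i≤j) ⟩
    k + j ∸ i + 1    ≡⟨ ≡.cong (_+ 1) (ℕₚ.+-∸-assoc k i≤j) ⟩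
    k + (j ∸ i) + 1  ∎
    where open ≡.≡-Reasoning

  index-high : ∀ {i k} j → i ≤ k → k + j + 1 ∸ (suc j + (k ∸ i)) ≡ i
  index-high {i} {k} j i≤k = begin
    k + j + 1 ∸ s              ≡⟨ ≡.cong (λ x → x + j + 1 ∸ s) (ℕₚ.m∸n+n≡m i≤k) ⟨
    (k ∸ i) + i + j + 1 ∸ s    ≡⟨ ≡.cong (_∸ s) (regroup (k ∸ i) i j) ⟩
    s + i ∸ s                  ≡⟨ ℕₚ.m+n∸m≡n s i ⟩
    i                          ∎
    where
    open ≡.≡-Reasoning
    s = suc j + (k ∸ i)
    regroup : ∀ x i j → x + i + j + 1 ≡ suc j + x + i
    regroup = solve-∀

open Indices

module _ {c ℓ : Level} (R : CommutativeRing c ℓ) where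
  open CommutativeRing R
  open Poly R
  open import Relation.Binary.Reasoning.Setoid setoid

  sumTo-cong : ∀ {f g} n → (∀ i → i < n → f i ≈ g i) → sumTo f n ≈ sumTo g n
  sumTo-cong zero    f≈g = refl
  sumTo-cong (suc n) f≈g =
    +-cong (sumTo-cong n (λ i i<n → f≈g i (ℕₚ.m≤n⇒m≤1+n i<n))) (f≈g n ℕₚ.≤-refl)

  sumTo-zero : ∀ {f} n → (∀ i → i < n → f i ≈ 0#) → sumTo f n ≈ 0#
  sumTo-zero zero    f≈0 = refl
  sumTo-zero (suc n) f≈0 = trans
    (+-cong (sumTo-zero n (λ i i<n → f≈0 i (ℕₚ.m≤n⇒m≤1+n i<n))) (f≈0 n ℕₚ.≤-refl))
    (+-identityˡ 0#)

  sumTo-single : ∀ {f} i n → i < n → (∀ l → l < n → l ≢ i → f l ≈ 0#) → sumTo f n ≈ f i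
  sumTo-single {f} i (suc n) i<1+n f≈0 with ℕₚ.m≤n⇒m<n∨m≡n (s≤s⁻¹ i<1+n)
  ... | inj₁ i<n = begin
    sumTo f n + f n  ≈⟨ +-cong (sumTo-single i n i<n (λ l l<n → f≈0 l (ℕₚ.m≤n⇒m≤1+n l<n)))
                               (f≈0 n ℕₚ.≤-refl (ℕₚ.>⇒≢ i<n)) ⟩
    f i + 0#         ≈⟨ +-identityʳ (f i) ⟩
    f i              ∎
  ... | inj₂ ≡.refl = begin
    sumTo f i + f i  ≈⟨ +-cong (sumTo-zero i (λ l l<i → f≈0 l (ℕₚ.m≤n⇒m≤1+n l<i) (ℕₚ.<⇒≢ l<i))) refl ⟩
    0# + f i         ≈⟨ +-identityˡ (f i) ⟩
    f i              ∎

  sumTo-head : ∀ f n → sumTo f (suc n) ≈ f 0 + sumTo (f ∘ suc) n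
  sumTo-head f zero    = +-comm 0# (f 0)
  sumTo-head f (suc n) = trans (+-cong (sumTo-head f n) refl) (+-assoc _ _ _)

  sumTo-+ : ∀ f a b → sumTo f (a Nat.+ b) ≈ sumTo f a + sumTo (λ i → f (a Nat.+ i)) b
  sumTo-+ f a zero    rewrite ℕₚ.+-identityʳ a = sym (+-identityʳ _)
  sumTo-+ f a (suc b) rewrite ℕₚ.+-suc a b =
    trans (+-cong (sumTo-+ f a b) refl) (+-assoc _ _ _)

  sumTo-reverse : ∀ f n → sumTo f n ≈ sumTo (λ i → f (n ∸ suc i)) n
  sumTo-reverse f zero    = refl
  sumTo-reverse f (suc n) = begin
    sumTo f n + f n                          ≈⟨ +-comm _ _ ⟩
    f n + sumTo f n                          ≈⟨ +-cong refl (sumTo-reverse f n) ⟩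
    f n + sumTo (λ i → f (n ∸ suc i)) n      ≈⟨ sumTo-head (λ i → f (suc n ∸ suc i)) n ⟨
    sumTo (λ i → f (suc n ∸ suc i)) (suc n)  ∎

  coeff-≥length : ∀ p {i} → length p ≤ i → coeff p i ≡ 0#
  coeff-≥length []      _           = ≡.refl
  coeff-≥length (_ ∷ p) (s≤s len≤i) = coeff-≥length p len≤i

  coeff-deg< : ∀ g {n} → deg g ≤ n → coeff g (n Nat.+ 1) ≡ 0#
  coeff-deg< g {n} deg≤n = coeff-≥length g (ℕₚ.≤-trans (ℕₚ.m≤n+m∸n (length g) 1)
    (ℕₚ.≤-trans (s≤s deg≤n) (ℕₚ.≤-reflexive (ℕₚ.+-comm 1 n))))

  coeff-applyUpTo : ∀ f L → (∀ j → L ≤ j → f j ≈ 0#) → ∀ j → coeff (applyUpTo f L) j ≈ f j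
  coeff-applyUpTo f zero    f≈0 j       = sym (f≈0 j z≤n)
  coeff-applyUpTo f (suc L) f≈0 zero    = refl
  coeff-applyUpTo f (suc L) f≈0 (suc j) =
    coeff-applyUpTo (f ∘ suc) L (λ i L≤i → f≈0 (suc i) (s≤s L≤i)) j

  coeff-map-upTo : ∀ φ L → (∀ j → L ≤ j → φ j ≈ 0#) → ∀ j → coeff (map φ (upTo L)) j ≈ φ j
  coeff-map-upTo φ L φ≈0 j rewrite map-upTo φ L = coeff-applyUpTo φ L φ≈0 j

  coeff-D : ∀ g i j → coeff (D g i) j ≈ coeff g (i Nat.+ j Nat.+ 1)
  coeff-D g i = coeff-map-upTo _ (deg g ∸ i) λ j deg∸i≤j → reflexive (coeff-deg< g
    (ℕₚ.≤-trans (ℕₚ.m≤n+m∸n (deg g) i) (ℕₚ.+-monoʳ-≤ i deg∸i≤j)))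

  coeff-*ₚ : ∀ p r N → coeff (p *ₚ r) N ≈ sumTo (λ i → coeff p i * coeff r (N ∸ i)) (suc N)
  coeff-*ₚ p r = coeff-map-upTo _ (length p Nat.+ length r ∸ 1)
    λ N len≤N → sumTo-zero (suc N) (λ i _ → term-vanishes N i len≤N)
    where
    term-vanishes : ∀ N i → length p Nat.+ length r ∸ 1 ≤ N → coeff p i * coeff r (N ∸ i) ≈ 0#
    term-vanishes N i len≤N with i Nat.<? length p
    ... | yes i<len = trans (*-cong refl (reflexive (coeff-≥length r (ℕₚ.m+n≤o⇒m≤o∸n (length r)
            (≡.subst (_≤ N) (ℕₚ.+-comm i (length r))
              (ℕₚ.≤-trans (ℕₚ.∸-monoˡ-≤ 1 (ℕₚ.+-monoˡ-≤ (length r) i<len)) len≤N))))))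
          (zeroʳ _)
    ... | no i≮len = trans (*-cong (reflexive (coeff-≥length p (ℕₚ.≮⇒≥ i≮len))) refl) (zeroˡ _)

  coeff-monom-self : ∀ i → coeff (monom i) i ≡ 1#
  coeff-monom-self zero    = ≡.refl
  coeff-monom-self (suc i) = coeff-monom-self i

  coeff-monom-≢ : ∀ i l → l ≢ i → coeff (monom i) l ≡ 0#
  coeff-monom-≢ zero    zero    l≢i = ⊥-elim (l≢i ≡.refl)
  coeff-monom-≢ zero    (suc l) _   = ≡.refl
  coeff-monom-≢ (suc i) zero    _   = ≡.refl
  coeff-monom-≢ (suc i) (suc l) l≢i = coeff-monom-≢ i l (l≢i ∘ ≡.cong suc)

  sumTo-monom : ∀ i n (h : ℕ → Carrier) → i < n → sumTo (λ l → coeff (monom i) l * h l) n ≈ h i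
  sumTo-monom i n h i<n = begin
    sumTo (λ l → coeff (monom i) l * h l) n  ≈⟨ sumTo-single i n i<n (λ l _ l≢i →
                                                  trans (*-cong (reflexive (coeff-monom-≢ i l l≢i)) refl) (zeroˡ _)) ⟩
    coeff (monom i) i * h i                  ≈⟨ *-cong (reflexive (coeff-monom-self i)) refl ⟩
    1# * h i                                 ≈⟨ *-identityˡ (h i) ⟩
    h i                                      ∎

  sumTo-monom-≥ : ∀ i n (h : ℕ → Carrier) → n ≤ i → sumTo (λ l → coeff (monom i) l * h l) n ≈ 0#
  sumTo-monom-≥ i n h n≤i = sumTo-zero n λ l l<n →
    trans (*-cong (reflexive (coeff-monom-≢ i l (ℕₚ.<⇒≢ (ℕₚ.<-≤-trans l<n n≤i)))) refl) (zeroˡ _)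

  foldr-+₂-applyUpTo : ∀ (F : ℕ → Poly2) f d j k →
    foldr (λ i acc → F i +₂ acc) 0₂ (applyUpTo f d) j k ≈ sumTo (λ i → F (f i) j k) d
  foldr-+₂-applyUpTo F f zero    j k = refl
  foldr-+₂-applyUpTo F f (suc d) j k = trans
    (+-cong refl (foldr-+₂-applyUpTo F (f ∘ suc) d j k))
    (sym (sumTo-head (λ i → F (f i) j k) d))

  mulX2-cong : ∀ p {P Q} → P ≈₂ Q → mulX2 p P ≈₂ mulX2 p Q
  mulX2-cong p P≈Q j k = sumTo-cong (suc k) (λ i _ → *-cong refl (P≈Q j (k ∸ i)))

  inX1-pos : ∀ p j {x} → 0 < x → inX1 p j x ≡ 0#
  inX1-pos p j {suc x} _ = ≡.refl

  mulX2-monom-inX1-≢ : ∀ i p j k → i ≢ k → mulX2 (monom i) (inX1 p) j k ≈ 0#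
  mulX2-monom-inX1-≢ i p j k i≢k with ℕₚ.<-cmp i k
  ... | tri< i<k _ _ = trans (sumTo-monom i (suc k) _ (s≤s (ℕₚ.<⇒≤ i<k)))
                             (reflexive (inX1-pos p j (ℕₚ.m<n⇒0<n∸m i<k)))
  ... | tri≈ _ i≡k _ = ⊥-elim (i≢k i≡k)
  ... | tri> _ _ k<i = sumTo-monom-≥ i (suc k) _ k<i

  mulX2-monom-inX1-self : ∀ p j k → mulX2 (monom k) (inX1 p) j k ≈ coeff p j
  mulX2-monom-inX1-self p j k = trans (sumTo-monom k (suc k) _ ℕₚ.≤-refl)
                                      (reflexive (≡.cong (inX1 p j) (ℕₚ.n∸n≡0 k)))

  O2-coeff : ∀ g j k → O2 g j k ≈ coeff g (k Nat.+ j Nat.+ 1)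
  O2-coeff g j k = trans (foldr-+₂-applyUpTo term id (deg g) j k) (select (k Nat.<? deg g))
    where
    term : ℕ → Poly2
    term i = mulX2 (monom i) (inX1 (D g i))
    select : Dec (k < deg g) → sumTo (λ i → term i j k) (deg g) ≈ coeff g (k Nat.+ j Nat.+ 1)
    select (yes k<deg) = begin
      sumTo (λ i → term i j k) (deg g)
        ≈⟨ sumTo-single k (deg g) k<deg (λ i _ i≢k → mulX2-monom-inX1-≢ i (D g i) j k i≢k) ⟩
      term k j k
        ≈⟨ mulX2-monom-inX1-self (D g k) j k ⟩
      coeff (D g k) j
        ≈⟨ coeff-D g k j ⟩
      coeff g (k Nat.+ j Nat.+ 1)
        ∎
    select (no k≮deg) = begin
      sumTo (λ i → term i j k) (deg g)
        ≈⟨ sumTo-zero (deg g) (λ i i<deg → mulX2-monom-inX1-≢ i (D g i) j k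
             (ℕₚ.<⇒≢ (ℕₚ.<-≤-trans i<deg (ℕₚ.≮⇒≥ k≮deg)))) ⟩
      0#
        ≡⟨ coeff-deg< g (ℕₚ.≤-trans (ℕₚ.≮⇒≥ k≮deg) (ℕₚ.m≤m+n k j)) ⟨
      coeff g (k Nat.+ j Nat.+ 1)
        ∎

  O2-*ₚ : ∀ m n → O2 (m *ₚ n) ≈₂ (mulX1 m (O2 n) +₂ mulX2 n (O2 m))
  O2-*ₚ m n j k = begin
    O2 (m *ₚ n) j k
      ≈⟨ O2-coeff (m *ₚ n) j k ⟩
    coeff (m *ₚ n) (k Nat.+ j Nat.+ 1)
      ≈⟨ coeff-*ₚ m n _ ⟩
    sumTo term (suc (k Nat.+ j Nat.+ 1))
      ≡⟨ ≡.cong (sumTo term) (split-point j k) ⟩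
    sumTo term (suc j Nat.+ suc k)
      ≈⟨ sumTo-+ term (suc j) (suc k) ⟩
    sumTo term (suc j) + sumTo (λ i → term (suc j Nat.+ i)) (suc k)
      ≈⟨ +-cong low high ⟩
    mulX1 m (O2 n) j k + mulX2 n (O2 m) j k
      ∎
    where
    term : ℕ → Carrier
    term i = coeff m i * coeff n (k Nat.+ j Nat.+ 1 ∸ i)
    low : sumTo term (suc j) ≈ mulX1 m (O2 n) j k
    low = sumTo-cong (suc j) λ i i≤j → *-cong refl (begin
      coeff n (k Nat.+ j Nat.+ 1 ∸ i)
        ≡⟨ ≡.cong (coeff n) (index-low k (s≤s⁻¹ i≤j)) ⟩
      coeff n (k Nat.+ (j ∸ i) Nat.+ 1)
        ≈⟨ O2-coeff n (j ∸ i) k ⟨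
      O2 n (j ∸ i) k
        ∎)
    high : sumTo (λ i → term (suc j Nat.+ i)) (suc k) ≈ mulX2 n (O2 m) j k
    high = trans (sumTo-reverse _ (suc k)) (sumTo-cong (suc k) λ i i≤k → begin
      term (suc j Nat.+ (k ∸ i))
        ≈⟨ *-comm _ _ ⟩
      coeff n (k Nat.+ j Nat.+ 1 ∸ (suc j Nat.+ (k ∸ i))) * coeff m (suc j Nat.+ (k ∸ i))
        ≡⟨ ≡.cong₂ (λ a b → coeff n a * coeff m b) (index-high j (s≤s⁻¹ i≤k)) (index-swap j (k ∸ i)) ⟩
      coeff n i * coeff m ((k ∸ i) Nat.+ j Nat.+ 1)
        ≈⟨ *-cong refl (O2-coeff m j (k ∸ i)) ⟨
      coeff n i * O2 m j (k ∸ i)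
        ∎)

  O2-linear : ∀ a → O2 (a ∷ 1# ∷ []) ≈₂ inX1 (1# ∷ [])
  O2-linear a zero    zero    = O2-coeff (a ∷ 1# ∷ []) 0 0
  O2-linear a j       (suc k) =
    trans (O2-coeff (a ∷ 1# ∷ []) j (suc k)) (reflexive (coeff-deg< (a ∷ 1# ∷ []) {suc k Nat.+ j} (s≤s z≤n)))
  O2-linear a (suc j) zero    =
    trans (O2-coeff (a ∷ 1# ∷ []) (suc j) 0) (reflexive (coeff-deg< (a ∷ 1# ∷ []) {suc j} (s≤s z≤n)))

  mulX2-inX1-one : ∀ p → mulX2 p (inX1 (1# ∷ [])) ≈₂ inX2 p
  mulX2-inX1-one p zero    k = begin
    mulX2 p (inX1 (1# ∷ [])) 0 k       ≈⟨ sumTo-single k (suc k) ℕₚ.≤-refl (λ i i≤k i≢k →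
                                           trans (*-cong refl (reflexive (inX1-pos _ 0
                                             (ℕₚ.m<n⇒0<n∸m (ℕₚ.≤∧≢⇒< (s≤s⁻¹ i≤k) i≢k)))))
                                             (zeroʳ _)) ⟩
    coeff p k * inX1 (1# ∷ []) 0 (k ∸ k) ≡⟨ ≡.cong (λ x → coeff p k * inX1 (1# ∷ []) 0 x) (ℕₚ.n∸n≡0 k) ⟩
    coeff p k * 1#                     ≈⟨ *-identityʳ (coeff p k) ⟩
    coeff p k                          ∎
  mulX2-inX1-one p (suc j) k = sumTo-zero (suc k) λ i _ →
    trans (*-cong refl (reflexive (inX1-one-suc (k ∸ i)))) (zeroʳ _)
    where
    inX1-one-suc : ∀ x → inX1 (1# ∷ []) (suc j) x ≡ 0#
    inX1-one-suc zero    = ≡.refl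
    inX1-one-suc (suc x) = ≡.refl

  O2-*ₚ-linear : ∀ a n → O2 ((a ∷ 1# ∷ []) *ₚ n) ≈₂ (mulX1 (a ∷ 1# ∷ []) (O2 n) +₂ inX2 n)
  O2-*ₚ-linear a n j k = trans (O2-*ₚ (a ∷ 1# ∷ []) n j k)
    (+-cong refl (trans (mulX2-cong n (O2-linear a) j k) (mulX2-inX1-one n j k)))

lemma2p14 : ∀ {c ℓ : Level} (F : FiniteField c ℓ) →
  let open FiniteField F
      open Poly commRing
  in (∀ (m n : Poly) → Monic m → 1 ≤ deg m → Monic n → 1 ≤ deg n →
        O2 (m *ₚ n) ≈₂ (mulX1 m (O2 n) +₂ mulX2 n (O2 m)))
     × (∀ (ζ : Carrier) (n : Poly) → Monic n → 1 ≤ deg n →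
        O2 ((- ζ ∷ 1# ∷ []) *ₚ n) ≈₂ (mulX1 (- ζ ∷ 1# ∷ []) (O2 n) +₂ inX2 n))
lemma2p14 F = (λ m n _ _ _ _ → O2-*ₚ commRing m n)
            , (λ ζ n _ _ → O2-*ₚ-linear commRing (- ζ) n)
  where open FiniteField F
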